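{- Let $T_3=\{(x,y)\in\mathbb{N}^2\mid x+y\le 4\}$. Then $\mathrm{gon}(R(T_3))=3$.
   Context: $\mathbb{N}=\{1,2,3,\dots\}$. For a finite set $F\subset\mathbb{N}^2$, the Ferrers rook graph $R(F)$ is the simple graph with vertex set $F$ in which distinct $(x,y),(x',y')$ are adjacent iff $x=x'$ or $y=y'$. Chip firing: firing a vertex sends one chip to each neighbor; divisors are equivalent if related by firings. An effective divisor $D$ has positive rank if for every vertex $v$ there is an effective divisor equivalent to $D$ with a positive number of chips at $v$. The gonality $\mathrm{gon}(G)$ is the minimum degree of an effective divisor of positive rank on $G$. -}

module Defs where

open import Data.Nat as ℕ using (ℕ; suc; _≤?_)
open import Data.Integer as ℤ using (ℤ; +_; _-_; _≤_; _<_)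
open import Data.Fin using (Fin)
open import Data.Fin.Properties using () renaming (_≟_ to _≟ᶠ_)
open import Data.List using (List; length; lookup; filter; map; foldr; concatMap; upTo; allFin; []; _∷_)
open import Data.Product using (_×_; _,_; proj₁; proj₂; ∃; ∃-syntax)
open import Data.Bool using (Bool; true; false; if_then_else_; _∧_; _∨_; not)
open import Relation.Nullary.Decidable using (⌊_⌋)
open import Relation.Binary.PropositionalEquality using (_≡_)
open import Relation.Binary.Construct.Closure.Equivalence using (EqClosure)

-- A finite set F ⊆ ℕ² is given as a duplicate-free list of points.
-- Vertices of R(F) are the positions in that list.
Vertex : List (ℕ × ℕ) → Set
Vertex F = Fin (length F)

point : (F : List (ℕ × ℕ)) → Vertex F → ℕ × ℕ
point F v = lookup F v

adj : (F : List (ℕ × ℕ)) → Vertex F → Vertex F → Bool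
adj F v w = not ⌊ v ≟ᶠ w ⌋ ∧
  (⌊ proj₁ (point F v) ℕ.≟ proj₁ (point F w) ⌋ ∨ ⌊ proj₂ (point F v) ℕ.≟ proj₂ (point F w) ⌋)

degree : (F : List (ℕ × ℕ)) → Vertex F → ℕ
degree F v = length (filter (λ w → adj F v w ≡? true) (allFin (length F)))
  where
  open import Data.Bool.Properties using () renaming (_≟_ to _≡?_)

Divisor : List (ℕ × ℕ) → Set
Divisor F = Vertex F → ℤ

fire : (F : List (ℕ × ℕ)) → Vertex F → Divisor F → Divisor F
fire F v D w =
  if ⌊ w ≟ᶠ v ⌋ then D w - + degree F v
  else (if adj F v w then D w ℤ.+ + 1 else D w)

FireStep : (F : List (ℕ × ℕ)) → Divisor F → Divisor F → Set
FireStep F D D' = ∃[ v ] ((w : Vertex F) → D' w ≡ fire F v D w)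

Equivalent : (F : List (ℕ × ℕ)) → Divisor F → Divisor F → Set
Equivalent F D D' = EqClosure (FireStep F) D D'

Effective : (F : List (ℕ × ℕ)) → Divisor F → Set
Effective F D = (v : Vertex F) → + 0 ≤ D v

deg : (F : List (ℕ × ℕ)) → Divisor F → ℤ
deg F D = foldr ℤ._+_ (+ 0) (map D (allFin (length F)))

PositiveRank : (F : List (ℕ × ℕ)) → Divisor F → Set
PositiveRank F D = Effective F D ×
  ((v : Vertex F) → ∃[ E ] (Equivalent F D E × Effective F E × + 0 < E v))

GonalityIs : (F : List (ℕ × ℕ)) → ℕ → Set
GonalityIs F k =
  (∃[ D ] (PositiveRank F D × deg F D ≡ + k)) ×
  ((D : Divisor F) → PositiveRank F D → + k ≤ deg F D)

-- T₃ = {(x,y) ∈ ℕ² | x+y ≤ 4}, ℕ = {1,2,...}; all such points have x,y ∈ {1..4}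
range1-4 : List ℕ
range1-4 = map suc (upTo 4)

T₃ : List (ℕ × ℕ)
T₃ = filter (λ p → proj₁ p ℕ.+ proj₂ p ≤? 4)
       (concatMap (λ x → map (λ y → (x , y)) range1-4) range1-4)

{-# OPTIONS --safe #-}
-- The divisor (1,2) + (1,3) + (2,2) has positive rank: firing {(1,2),(1,3),(2,2)} turns it
-- into 2·(1,1) + (2,1), and then firing every vertex except (3,1) gives (1,1) + 2·(3,1).
-- For the lower bound, the weights w = (0,2,1,8,5,19) satisfy L w ≡ 0 (mod 30) for the
-- Laplacian L, so the degree and φ D = Σ w·D mod 30 are invariant under firing.
-- Enumerating the effective divisors of degree ≤ 2 shows that these invariants always
-- single out a vertex on which no effective divisor with the same invariants has a chip,
-- so no divisor of degree ≤ 2 has positive rank.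
module Submission where

open import Defs
open import Data.Bool.Base using (true; false; if_then_else_)
open import Data.Fin.Base using (Fin; toℕ; fromℕ<)
open import Data.Fin.Patterns using (0F; 1F; 2F; 3F; 4F; 5F)
open import Data.Fin.Properties using (all?; toℕ-fromℕ<) renaming (_≟_ to _≟ᶠ_)
open import Data.Integer.Base
  using (ℤ; +_; -[1+_]; 0ℤ; _+_; _-_; -_; _*_; _≤_; _<_; +≤+; ∣_∣; _%ℕ_; nonNegative)
import Data.Integer.Properties as ℤ
open import Algebra.Properties.CommutativeSemigroup ℤ.+-commutativeSemigroup using (interchange)
open import Data.Integer.Tactic.RingSolver using (solve-∀)
open import Data.List.Base using (List; []; _∷_; foldr; map; allFin; length)
open import Data.List.Membership.Propositional using (_∈_)
open import Data.List.Membership.Propositional.Properties using (∈-allFin)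
open import Data.List.Properties using (map-cong)
open import Data.List.Relation.Unary.Any using (here; there)
open import Data.Nat.Base as ℕ using (ℕ; NonZero)
open import Data.Nat.DivMod using (%-congˡ; [m+kn]%n≡m%n)
open import Data.Product.Base using (_×_; _,_; proj₁; proj₂; ∃-syntax)
open import Data.Product.Relation.Binary.Pointwise.NonDependent using (×-isEquivalence)
open import Data.Vec.Base using (Vec; []; _∷_; lookup; tabulate)
open import Data.Vec.Properties using (lookup∘tabulate)
open import Function.Base using (_∘_)
open import Relation.Binary.Construct.Closure.Equivalence using (gfold)
open import Relation.Binary.Construct.Closure.ReflexiveTransitive using (ε; _◅_)
open import Relation.Binary.Construct.Closure.Symmetric using (fwd)
open import Relation.Binary.PropositionalEquality
open import Relation.Binary.Structures using (IsEquivalence)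
open import Relation.Nullary.Decidable using (Dec; ⌊_⌋; map′; from-yes; _→-dec_; _×-dec_)

private variable
  k n : ℕ
  F : List (ℕ × ℕ)

*-nonNeg : ∀ {i j} → 0ℤ ≤ i → 0ℤ ≤ j → 0ℤ ≤ i * j
*-nonNeg {i} i≥0 j≥0 =
  subst (_≤ i * _) (ℤ.*-zeroʳ i) (ℤ.*-monoˡ-≤-nonNeg i {{nonNegative i≥0}} j≥0)

infix 4 _≡[mod_]_

_≡[mod_]_ : ℤ → ℕ → ℤ → Set
i ≡[mod n ] j = ∃[ k ] i ≡ j + k * + n

≡mod-refl : ∀ {i} → i ≡[mod n ] i
≡mod-refl = 0ℤ , sym (ℤ.+-identityʳ _)

≡mod-sym : ∀ {i j} → i ≡[mod n ] j → j ≡[mod n ] i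
≡mod-sym {n} {j = j} (k , i≡j+kn) =
  - k , trans (cancel j k (+ n)) (cong (λ x → x + - k * + n) (sym i≡j+kn))
  where
  cancel : ∀ j k c → j ≡ (j + k * c) + - k * c
  cancel = solve-∀

≡mod-trans : ∀ {i j l} → i ≡[mod n ] j → j ≡[mod n ] l → i ≡[mod n ] l
≡mod-trans {n} {l = l} (k , i≡j+kn) (m , j≡l+mn) =
  m + k , trans i≡j+kn (trans (cong (λ x → x + k * + n) j≡l+mn) (regroup l m k (+ n)))
  where
  regroup : ∀ l m k c → (l + m * c) + k * c ≡ l + (m + k) * c
  regroup = solve-∀

≡mod-isEquivalence : ∀ n → IsEquivalence (λ i j → i ≡[mod n ] j)
≡mod-isEquivalence n = record
  { refl  = ≡mod-refl {n}
  ; sym   = ≡mod-sym {n}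
  ; trans = λ {i j l} → ≡mod-trans {n} {i} {j} {l}
  }

a≡b+kn⇒a%n≡b%n : ∀ {a b} k .{{_ : NonZero n}} → + a ≡ + b + + k * + n → a ℕ.% n ≡ b ℕ.% n
a≡b+kn⇒a%n≡b%n {n} {b = b} k a≡b+kn =
  trans (%-congˡ (ℤ.+-injective (trans a≡b+kn (cong (_+_ (+ b)) (sym (ℤ.pos-* k n))))))
        ([m+kn]%n≡m%n b k n)

≡mod⇒%ℕ≡ : ∀ {i j} .{{_ : NonZero n}} → 0ℤ ≤ i → 0ℤ ≤ j → i ≡[mod n ] j → i %ℕ n ≡ j %ℕ n
≡mod⇒%ℕ≡ (+≤+ _) (+≤+ _) (+ k , i≡j+kn)      = a≡b+kn⇒a%n≡b%n k i≡j+kn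
≡mod⇒%ℕ≡ (+≤+ _) (+≤+ _) i≡j@(-[1+ k ] , _) =
  sym (a≡b+kn⇒a%n≡b%n (ℕ.suc k) (proj₂ (≡mod-sym i≡j)))

module _ {A : Set} where

  sumOf : (A → ℤ) → List A → ℤ
  sumOf f xs = foldr _+_ 0ℤ (map f xs)

  sumOf-+ : ∀ (f g : A → ℤ) xs → sumOf (λ x → f x + g x) xs ≡ sumOf f xs + sumOf g xs
  sumOf-+ f g []       = refl
  sumOf-+ f g (x ∷ xs) =
    trans (cong (_+_ (f x + g x)) (sumOf-+ f g xs)) (interchange (f x) (g x) _ _)

  sumOf-nonNeg : ∀ {f : A → ℤ} → (∀ x → 0ℤ ≤ f x) → ∀ xs → 0ℤ ≤ sumOf f xs
  sumOf-nonNeg f≥0 []       = ℤ.≤-refl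
  sumOf-nonNeg f≥0 (x ∷ xs) = ℤ.+-mono-≤ (f≥0 x) (sumOf-nonNeg f≥0 xs)

  ∈⇒≤sumOf : ∀ {f : A → ℤ} {x xs} → (∀ x → 0ℤ ≤ f x) → x ∈ xs → f x ≤ sumOf f xs
  ∈⇒≤sumOf f≥0 (here {xs = xs} refl) = ℤ.i≤i+j _ _ {{nonNegative (sumOf-nonNeg f≥0 xs)}}
  ∈⇒≤sumOf {f} f≥0 (there {x = y} x∈xs) =
    ℤ.i≤j⇒i≤k+j (f y) {{nonNegative (f≥0 y)}} (∈⇒≤sumOf f≥0 x∈xs)

all-vectors? : ∀ {k n} {P : Vec (Fin k) n → Set} → (∀ t → Dec (P t)) → Dec (∀ t → P t)
all-vectors? {n = ℕ.zero}  P? = map′ (λ P[] → λ { [] → P[] }) (λ ∀P → ∀P []) (P? [])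
all-vectors? {n = ℕ.suc _} P? =
  map′ (λ ∀P → λ { (x ∷ xs) → ∀P x xs }) (λ ∀P x xs → ∀P (x ∷ xs))
       (all? λ x → all-vectors? λ xs → P? (x ∷ xs))

infixl 6 _+ᴰ_
infixl 7 _·ᴰ_

0ᴰ : Fin n → ℤ
0ᴰ _ = 0ℤ

_+ᴰ_ : (Fin n → ℤ) → (Fin n → ℤ) → Fin n → ℤ
(D +ᴰ E) v = D v + E v

_·ᴰ_ : (Fin n → ℤ) → (Fin n → ℤ) → Fin n → ℤ
(c ·ᴰ D) v = c v * D v

deg-cong : ∀ F {D E : Divisor F} → D ≗ E → deg F D ≡ deg F E
deg-cong F D≗E = cong (foldr _+_ 0ℤ) (map-cong D≗E (allFin (length F)))

deg-+ᴰ : ∀ F (D E : Divisor F) → deg F (D +ᴰ E) ≡ deg F D + deg F E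
deg-+ᴰ F D E = sumOf-+ D E (allFin (length F))

effective⇒0≤deg : ∀ F {D : Divisor F} → Effective F D → 0ℤ ≤ deg F D
effective⇒0≤deg F D≥0 = sumOf-nonNeg D≥0 (allFin (length F))

effective⇒≤deg : ∀ F {D : Divisor F} → Effective F D → ∀ v → D v ≤ deg F D
effective⇒≤deg F D≥0 v = ∈⇒≤sumOf D≥0 (∈-allFin v)

fire≗+fire0ᴰ : ∀ F v (D : Divisor F) → fire F v D ≗ D +ᴰ fire F v 0ᴰ
fire≗+fire0ᴰ F v D w = shift ⌊ w ≟ᶠ v ⌋ (adj F v w) (D w)
  where
  shift : ∀ b c x → (if b then x - + degree F v else if c then x + + 1 else x)
                  ≡ x + (if b then 0ℤ - + degree F v else if c then 0ℤ + + 1 else 0ℤ)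
  shift true  _     x = cong (_+_ x) (sym (ℤ.+-identityˡ _))
  shift false true  x = refl
  shift false false x = sym (ℤ.+-identityʳ x)

fireAll : ∀ F → List (Vertex F) → Divisor F → Divisor F
fireAll F []       D = D
fireAll F (v ∷ vs) D = fireAll F vs (fire F v D)

fireAll-equivalent : ∀ F vs (D : Divisor F) → Equivalent F D (fireAll F vs D)
fireAll-equivalent F []       D = ε
fireAll-equivalent F (v ∷ vs) D = fwd (v , λ _ → refl) ◅ fireAll-equivalent F vs (fire F v D)

effective? : ∀ F (D : Divisor F) → Dec (Effective F D)
effective? F D = all? λ v → 0ℤ ℤ.≤? D v

counts : Vec (Fin k) n → Fin n → ℤ
counts t v = + toℕ (lookup t v)

effective⇒≗counts : ∀ F {D : Divisor F} {k} → Effective F D → deg F D < + k →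
                    ∃[ t ] D ≗ counts {k = k} t
effective⇒≗counts F {D} {k} D≥0 deg<k = tabulate (λ v → fromℕ< (bound v)) , D≗counts
  where
  bound : ∀ v → ∣ D v ∣ ℕ.< k
  bound v = ℤ.drop‿+<+ (subst (_< + k) (sym (ℤ.0≤i⇒+∣i∣≡i (D≥0 v)))
                                     (ℤ.≤-<-trans (effective⇒≤deg F D≥0 v) deg<k))
  D≗counts : D ≗ counts (tabulate (λ v → fromℕ< (bound v)))
  D≗counts v = begin
    D v                                                  ≡⟨ ℤ.0≤i⇒+∣i∣≡i (D≥0 v) ⟨
    + ∣ D v ∣                                            ≡⟨ cong +_ (toℕ-fromℕ< (bound v)) ⟨
    + toℕ (fromℕ< (bound v))                             ≡⟨ cong (+_ ∘ toℕ) (lookup∘tabulate _ v) ⟨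
    + toℕ (lookup (tabulate (λ u → fromℕ< (bound u))) v) ∎
    where open ≡-Reasoning

-- Vertices of R(T₃) in list order: 0F = (1,1), 1F = (1,2), 2F = (1,3), 3F = (2,1), 4F = (2,2),
-- 5F = (3,1).  The Laplacian of weight is (−30,0,0,0,0,30); since R(T₃) has 30 spanning trees
-- and weight 2F = 1, φ mod 30 identifies the Jacobian of R(T₃) with ℤ/30.
weight : Vertex T₃ → ℤ
weight 0F = + 0
weight 1F = + 2
weight 2F = + 1
weight 3F = + 8
weight 4F = + 5
weight 5F = + 19

φ : Divisor T₃ → ℤ
φ D = deg T₃ (weight ·ᴰ D)

φ-cong : {D E : Divisor T₃} → D ≗ E → φ D ≡ φ E
φ-cong D≗E = deg-cong T₃ (λ v → cong (weight v *_) (D≗E v))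

φ-nonNeg : {D : Divisor T₃} → Effective T₃ D → 0ℤ ≤ φ D
φ-nonNeg D≥0 = effective⇒0≤deg T₃ (λ v → *-nonNeg (weight≥0 v) (D≥0 v))
  where
  weight≥0 : ∀ v → 0ℤ ≤ weight v
  weight≥0 = from-yes (all? λ v → 0ℤ ℤ.≤? weight v)

fire0ᴰ-invariants : ∀ v → deg T₃ (fire T₃ v 0ᴰ) ≡ 0ℤ × φ (fire T₃ v 0ᴰ) ≡[mod 30 ] 0ℤ
fire0ᴰ-invariants 0F = refl , + 1 , refl
fire0ᴰ-invariants 1F = refl , 0ℤ , refl
fire0ᴰ-invariants 2F = refl , 0ℤ , refl
fire0ᴰ-invariants 3F = refl , 0ℤ , refl
fire0ᴰ-invariants 4F = refl , 0ℤ , refl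
fire0ᴰ-invariants 5F = refl , -[1+ 0 ] , refl

fire-invariants : ∀ v D → deg T₃ (fire T₃ v D) ≡ deg T₃ D × φ (fire T₃ v D) ≡[mod 30 ] φ D
fire-invariants v D = deg-fire , φ-fire
  where
  open ≡-Reasoning
  Δ : Divisor T₃
  Δ = fire T₃ v 0ᴰ
  deg-fire : deg T₃ (fire T₃ v D) ≡ deg T₃ D
  deg-fire = begin
    deg T₃ (fire T₃ v D) ≡⟨ deg-cong T₃ (fire≗+fire0ᴰ T₃ v D) ⟩
    deg T₃ (D +ᴰ Δ)      ≡⟨ deg-+ᴰ T₃ D Δ ⟩
    deg T₃ D + deg T₃ Δ  ≡⟨ cong (_+_ (deg T₃ D)) (proj₁ (fire0ᴰ-invariants v)) ⟩
    deg T₃ D + 0ℤ        ≡⟨ ℤ.+-identityʳ _ ⟩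
    deg T₃ D             ∎
  φ-fire : φ (fire T₃ v D) ≡[mod 30 ] φ D
  φ-fire = let k , φΔ≡30k = proj₂ (fire0ᴰ-invariants v) in k , (begin
    φ (fire T₃ v D)                     ≡⟨ φ-cong (fire≗+fire0ᴰ T₃ v D) ⟩
    deg T₃ (weight ·ᴰ (D +ᴰ Δ))         ≡⟨ deg-cong T₃ (λ u → ℤ.*-distribˡ-+ (weight u) (D u) (Δ u)) ⟩
    deg T₃ (weight ·ᴰ D +ᴰ weight ·ᴰ Δ) ≡⟨ deg-+ᴰ T₃ (weight ·ᴰ D) (weight ·ᴰ Δ) ⟩
    φ D + φ Δ                           ≡⟨ cong (_+_ (φ D)) (trans φΔ≡30k (ℤ.+-identityˡ _)) ⟩
    φ D + k * + 30                      ∎)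

equivalent-invariants : {D E : Divisor T₃} → Equivalent T₃ D E →
                        deg T₃ D ≡ deg T₃ E × φ D ≡[mod 30 ] φ E
equivalent-invariants =
  gfold (×-isEquivalence isEquivalence (≡mod-isEquivalence 30)) (λ D → deg T₃ D , φ D) step
  where
  step : {D E : Divisor T₃} → FireStep T₃ D E → deg T₃ D ≡ deg T₃ E × φ D ≡[mod 30 ] φ E
  step {D} (v , E≗fire) =
    let deg-fire , k , φ-fire = fire-invariants v D
    in sym (trans (deg-cong T₃ E≗fire) deg-fire) , ≡mod-sym (k , trans (φ-cong E≗fire) φ-fire)

-- avoidedVertex r is 0F unless some effective divisor of degree ≤ 2 containing (1,1) has
-- φ ≡ r; those residues are 0, 1, 2, 5, 8, 19, and only 2 is also the residue of one
-- containing (1,2), namely 2·(1,3).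
avoidedVertex : ℕ → Vertex T₃
avoidedVertex 0  = 1F
avoidedVertex 1  = 1F
avoidedVertex 2  = 3F
avoidedVertex 5  = 1F
avoidedVertex 8  = 1F
avoidedVertex 19 = 1F
avoidedVertex _  = 0F

MissesAvoidedVertex : Divisor T₃ → Set
MissesAvoidedVertex D = deg T₃ D < + 3 → D (avoidedVertex (φ D %ℕ 30)) ≡ 0ℤ

missesAvoidedVertex-cong : {D E : Divisor T₃} → D ≗ E → MissesAvoidedVertex E → MissesAvoidedVertex D
missesAvoidedVertex-cong D≗E E-misses deg<3 rewrite φ-cong D≗E =
  trans (D≗E _) (E-misses (subst (_< + 3) (deg-cong T₃ D≗E) deg<3))

counts-missAvoidedVertex : ∀ (t : Vec (Fin 3) (length T₃)) → MissesAvoidedVertex (counts t)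
counts-missAvoidedVertex = from-yes (all-vectors? {3} λ t →
  deg T₃ (counts t) ℤ.<? + 3 →-dec counts t (avoidedVertex (φ (counts t) %ℕ 30)) ℤ.≟ 0ℤ)

effective⇒missesAvoidedVertex : {D : Divisor T₃} → Effective T₃ D → MissesAvoidedVertex D
effective⇒missesAvoidedVertex D≥0 deg<3 =
  let t , D≗t = effective⇒≗counts T₃ D≥0 deg<3
  in missesAvoidedVertex-cong D≗t (counts-missAvoidedVertex t) deg<3

equivalent⇒missesAvoidedVertex : {D E : Divisor T₃} → Effective T₃ D → Effective T₃ E →
  Equivalent T₃ D E → deg T₃ D < + 3 → E (avoidedVertex (φ D %ℕ 30)) ≡ 0ℤ
equivalent⇒missesAvoidedVertex {E = E} D≥0 E≥0 D∼E deg<3 =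
  let degD≡degE , φD≡φE = equivalent-invariants D∼E
  in subst (λ r → E (avoidedVertex r) ≡ 0ℤ)
           (≡mod⇒%ℕ≡ (φ-nonNeg E≥0) (φ-nonNeg D≥0) (≡mod-sym φD≡φE))
           (effective⇒missesAvoidedVertex E≥0 (subst (_< + 3) degD≡degE deg<3))

positiveRank⇒3≤deg : {D : Divisor T₃} → PositiveRank T₃ D → + 3 ≤ deg T₃ D
positiveRank⇒3≤deg {D} (D≥0 , reach) = ℤ.≮⇒≥ λ deg<3 →
  let E , D∼E , E≥0 , 0<E = reach (avoidedVertex (φ D %ℕ 30))
  in ℤ.<-irrefl refl (subst (0ℤ <_) (equivalent⇒missesAvoidedVertex D≥0 E≥0 D∼E deg<3) 0<E)

gonalDivisor : Divisor T₃
gonalDivisor 1F = + 1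
gonalDivisor 2F = + 1
gonalDivisor 4F = + 1
gonalDivisor _  = 0ℤ

firingsToReach : Vertex T₃ → List (Vertex T₃)
firingsToReach 0F = 1F ∷ 2F ∷ 4F ∷ []
firingsToReach 3F = 1F ∷ 2F ∷ 4F ∷ []
firingsToReach 5F = 1F ∷ 2F ∷ 4F ∷ 0F ∷ 1F ∷ 2F ∷ 3F ∷ 4F ∷ []
firingsToReach _  = []

gonalDivisor-positiveRank : PositiveRank T₃ gonalDivisor
gonalDivisor-positiveRank = from-yes (effective? T₃ gonalDivisor) , λ v →
  fireAll T₃ (firingsToReach v) gonalDivisor , fireAll-equivalent T₃ (firingsToReach v) gonalDivisor , reached v
  where
  reached : ∀ v → let E = fireAll T₃ (firingsToReach v) gonalDivisor in Effective T₃ E × 0ℤ < E v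
  reached = from-yes (all? λ v → let E = fireAll T₃ (firingsToReach v) gonalDivisor in
    effective? T₃ E ×-dec 0ℤ ℤ.<? E v)

theorem4p3 : GonalityIs T₃ 3
theorem4p3 = (gonalDivisor , gonalDivisor-positiveRank , refl) , λ _ → positiveRank⇒3≤deg
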